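{- Let $r\geq 3$, let $m\geq1$, and let $D$ be an $m$-colored semicomplete $r$-partite digraph such that every directed $3$-cycle and every directed $4$-cycle contained in $D$ is monochromatic. Then $D$ has a $2$-colored kernel.
   Context: A digraph is $m$-colored if each arc is assigned one of $m$ colors. A semicomplete $r$-partite digraph is obtained from a complete $r$-partite graph by replacing each edge $uv$ by the arc $(u,v)$, the arc $(v,u)$, or both; no arcs join vertices of the same part. A subdigraph is monochromatic if all its arcs have the same color; "contained in $D$" means being a subdigraph of $D$. A directed path is at most $2$-colored if its arcs use at most $2$ distinct colors. A $2$-colored kernel of $D$ is a nonempty set $K\subseteq V(D)$ such that every vertex $u\notin K$ has an at most $2$-colored directed path to some vertex of $K$, and for every two distinct $u,v\in K$ there is no at most $2$-colored directed path from $u$ to $v$. -}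

module Defs where

open import Data.Nat using (ℕ)
open import Data.Fin using (Fin)
open import Data.Bool using (Bool; true; false)
open import Data.List using (List; []; _∷_)
open import Data.List.Relation.Unary.All using (All)
open import Data.List.Relation.Unary.Unique.Propositional using (Unique)
open import Data.Product using (Σ; ∃; _×_; _,_)
open import Data.Sum using (_⊎_)
open import Relation.Binary.PropositionalEquality using (_≡_; _≢_)
open import Relation.Nullary using (¬_)

-- A finite m-colored digraph on vertex set Fin n:
-- arc u v ≡ true means (u,v) is an arc; col u v is its color
-- (only meaningful when arc u v ≡ true).
record ColoredDigraph (n m : ℕ) : Set where
  field
    arc : Fin n → Fin n → Bool
    col : Fin n → Fin n → Fin m

module _ {n m : ℕ} (D : ColoredDigraph n m) where
  open ColoredDigraph D

  IsSemicompletePartite : (r : ℕ) → Set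
  IsSemicompletePartite r =
    Σ (Fin n → Fin r) λ part →
      ((i : Fin r) → ∃ λ v → part v ≡ i) ×
      ((u v : Fin n) → part u ≡ part v → arc u v ≡ false) ×
      ((u v : Fin n) → part u ≢ part v → (arc u v ≡ true) ⊎ (arc v u ≡ true))

  data Walk : Fin n → Fin n → Set where
    stop : ∀ {u} → Walk u u
    step : ∀ {u v w} → arc u v ≡ true → Walk v w → Walk u w

  vertices : ∀ {u w} → Walk u w → List (Fin n)
  vertices {u} stop = u ∷ []
  vertices {u} (step _ p) = u ∷ vertices p

  colors : ∀ {u w} → Walk u w → List (Fin m)
  colors stop = []
  colors {u} (step {v = v} _ p) = col u v ∷ colors p

  IsPath : ∀ {u w} → Walk u w → Set
  IsPath p = Unique (vertices p)

  AtMost2Colored : ∀ {u w} → Walk u w → Set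
  AtMost2Colored p = ∃ λ c₁ → ∃ λ c₂ → All (λ c → c ≡ c₁ ⊎ c ≡ c₂) (colors p)

  _⇝₂_ : Fin n → Fin n → Set
  u ⇝₂ w = Σ (Walk u w) λ p → IsPath p × AtMost2Colored p

  C3Monochromatic : Set
  C3Monochromatic = (a b c : Fin n) → a ≢ b → b ≢ c → a ≢ c →
    arc a b ≡ true → arc b c ≡ true → arc c a ≡ true →
    (col a b ≡ col b c) × (col b c ≡ col c a)

  C4Monochromatic : Set
  C4Monochromatic = (a b c d : Fin n) →
    a ≢ b → a ≢ c → a ≢ d → b ≢ c → b ≢ d → c ≢ d →
    arc a b ≡ true → arc b c ≡ true → arc c d ≡ true → arc d a ≡ true →
    (col a b ≡ col b c) × (col b c ≡ col c d) × (col c d ≡ col d a)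

  Is2ColoredKernel : (Fin n → Bool) → Set
  Is2ColoredKernel K =
    (∃ λ v → K v ≡ true) ×
    ((u : Fin n) → K u ≡ false → ∃ λ v → (K v ≡ true) × (u ⇝₂ v)) ×
    ((u v : Fin n) → K u ≡ true → K v ≡ true → u ≢ v → ¬ (u ⇝₂ v))

  Has2ColoredKernel : Set
  Has2ColoredKernel = ∃ λ K → Is2ColoredKernel K

module Submission where

-- Reachability u ⇝ v ("there is a directed walk from u to v") is a decidable
-- preorder on the finite vertex set.  For any such preorder, call u terminal if
-- everything reachable from u reaches u back and has index at least that of u,
-- i.e. u is the least-indexed vertex of a terminal strong component.  Every
-- vertex reaches a terminal vertex (descend along the lexicographic rank
-- (size of up-set, index)), and two terminal vertices reaching each other are
-- equal.  So the terminal vertices form a kernel for reachability.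
--
-- It remains to replace walks by at most 2-coloured paths.  In any digraph a
-- shortest walk is a path.  In a semicomplete multipartite digraph whose
-- directed 3- and 4-cycles are monochromatic, the first two arcs of any three
-- consecutive arcs of a shortest walk have the same colour (a chord would
-- shorten the walk, and a backward chord closes a 3- or 4-cycle).  Hence every
-- arc of a shortest walk except the last has the colour of the first arc, so
-- shortest walks are at most 2-coloured paths, and the terminal vertices form a
-- 2-coloured kernel.

open import Defs
open import Data.Nat using (ℕ; _≥_; zero; suc; _+_; _*_; _≤_; _<_; _≤?_; s≤s; z≤n)
open import Data.Nat.Properties
  using (≤-refl; ≤-trans; ≤-antisym; ≤-pred; n≤1+n; m≤m+n; <⇒≤; <⇒≱; ≰⇒>; ≮⇒≥;
         ≤-reflexive; +-comm; +-monoʳ-<; +-mono-≤-<; *-monoˡ-≤; module ≤-Reasoning)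
open import Data.Fin as Fin using (Fin; toℕ; _≟_)
open import Data.Fin.Properties using (any?; all?; ¬∀⟶∃¬; injective⇒≤; toℕ<n; toℕ-injective)
open import Data.Fin.Subset using (Subset; _∈_; _⊆_; _⊂_; ∣_∣)
open import Data.Fin.Subset.Properties using (p⊆q⇒∣p∣≤∣q∣; p⊂q⇒∣p∣<∣q∣)
open import Data.Bool using (Bool; true; false) renaming (_≟_ to _≟ᵇ_)
open import Data.Vec using (tabulate)
open import Data.Vec.Properties using (lookup∘tabulate; []=↔lookup)
open import Data.List using (List; length; lookup)
open import Data.List.Relation.Unary.All as All using (All; []; _∷_)
open import Data.List.Relation.Unary.Any using (here; there)
open import Data.List.Relation.Unary.All.Properties.Core using (¬Any⇒All¬)
open import Data.List.Relation.Unary.AllPairs using ([]; _∷_)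
open import Data.List.Relation.Unary.Unique.Propositional using (Unique)
open import Data.List.Membership.Propositional using () renaming (_∈_ to _∈ˡ_)
open import Data.List.Membership.Propositional.Properties using (∈-lookup)
open import Data.Product using (Σ; ∃; _×_; _,_; proj₁; proj₂)
open import Data.Sum using (_⊎_; inj₁; inj₂; [_,_])
open import Data.Empty using (⊥; ⊥-elim)
open import Function using (Injective)
open import Function.Bundles using (Inverse)
open import Data.Nat.Induction using (<-wellFounded)
open import Induction.WellFounded using (Acc; acc; WellFounded)
import Relation.Binary.Construct.On as On
open import Relation.Binary.PropositionalEquality using (_≡_; _≢_; refl; sym; trans; cong)
open import Relation.Nullary using (¬_; Dec; yes; no; does; contradiction)
open import Relation.Nullary.Decidable using (dec-true; _×-dec_; _→-dec_)

true⇒witness : ∀ {A : Set} (a? : Dec A) → does a? ≡ true → A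
true⇒witness (yes a) _ = a
true⇒witness (no _) ()

lookup-injective : ∀ {A : Set} {xs : List A} → Unique xs → Injective _≡_ _≡_ (lookup xs)
lookup-injective (_ ∷ _) {Fin.zero} {Fin.zero} _ = refl
lookup-injective (x∉xs ∷ _) {Fin.zero} {Fin.suc j} eq = contradiction eq (All.lookup x∉xs (∈-lookup j))
lookup-injective (x∉xs ∷ _) {Fin.suc i} {Fin.zero} eq = contradiction (sym eq) (All.lookup x∉xs (∈-lookup i))
lookup-injective (_ ∷ u) {Fin.suc i} {Fin.suc j} eq = cong Fin.suc (lookup-injective u eq)

unique⇒length≤ : ∀ {n} {xs : List (Fin n)} → Unique xs → length xs ≤ n
unique⇒length≤ u = injective⇒≤ (lookup-injective u)

module TerminalElements {n : ℕ} (_⇝_ : Fin n → Fin n → Set)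
  (⇝-refl : ∀ {u} → u ⇝ u) (⇝-trans : ∀ {u v w} → u ⇝ v → v ⇝ w → u ⇝ w)
  (_⇝?_ : ∀ u v → Dec (u ⇝ v)) where

  up : Fin n → Subset n
  up u = tabulate (λ x → does (u ⇝? x))

  ∈up⁺ : ∀ {u x} → u ⇝ x → x ∈ up u
  ∈up⁺ {u} {x} ux = Inverse.from []=↔lookup (trans (lookup∘tabulate _ x) (dec-true (u ⇝? x) ux))

  ∈up⁻ : ∀ {u x} → x ∈ up u → u ⇝ x
  ∈up⁻ {u} {x} x∈ = true⇒witness (u ⇝? x) (trans (sym (lookup∘tabulate _ x)) (Inverse.to []=↔lookup x∈))

  up-antitone : ∀ {u w} → u ⇝ w → up w ⊆ up u
  up-antitone uw x∈ = ∈up⁺ (⇝-trans uw (∈up⁻ x∈))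

  up-shrinks : ∀ {u w} → u ⇝ w → ¬ (w ⇝ u) → up w ⊂ up u
  up-shrinks {u} uw ¬wu = up-antitone uw , u , ∈up⁺ ⇝-refl , λ u∈ → ¬wu (∈up⁻ u∈)

  -- The lexicographic rank (size of the up-set, index), encoded in ℕ.
  rank : Fin n → ℕ
  rank u = ∣ up u ∣ * n + toℕ u

  rank-up : ∀ {u w} → u ⇝ w → ¬ (w ⇝ u) → rank w < rank u
  rank-up {u} {w} uw ¬wu = begin-strict
    ∣ up w ∣ * n + toℕ w  <⟨ +-monoʳ-< (∣ up w ∣ * n) (toℕ<n w) ⟩
    ∣ up w ∣ * n + n      ≡⟨ +-comm (∣ up w ∣ * n) n ⟩
    suc ∣ up w ∣ * n      ≤⟨ *-monoˡ-≤ n (p⊂q⇒∣p∣<∣q∣ (up-shrinks uw ¬wu)) ⟩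
    ∣ up u ∣ * n          ≤⟨ m≤m+n _ _ ⟩
    rank u                ∎
    where open ≤-Reasoning

  rank-index : ∀ {u w} → u ⇝ w → toℕ w < toℕ u → rank w < rank u
  rank-index uw = +-mono-≤-< (*-monoˡ-≤ n (p⊆q⇒∣p∣≤∣q∣ (up-antitone uw)))

  TerminalAt : Fin n → Fin n → Set
  TerminalAt u w = u ⇝ w → w ⇝ u × toℕ u ≤ toℕ w

  Terminal : Fin n → Set
  Terminal u = ∀ w → TerminalAt u w

  terminalAt? : ∀ u w → Dec (TerminalAt u w)
  terminalAt? u w = (u ⇝? w) →-dec ((w ⇝? u) ×-dec (toℕ u ≤? toℕ w))

  terminal? : ∀ u → Dec (Terminal u)
  terminal? u = all? (terminalAt? u)

  descend : ∀ {u} → ¬ Terminal u → ∃ λ w → u ⇝ w × rank w < rank u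
  descend {u} ¬t with ¬∀⟶∃¬ n _ (terminalAt? u) ¬t
  ... | w , ¬tw with u ⇝? w
  ...   | no ¬uw = ⊥-elim (¬tw (λ uw → contradiction uw ¬uw))
  ...   | yes uw with w ⇝? u
  ...     | no ¬wu = w , uw , rank-up uw ¬wu
  ...     | yes wu with toℕ u ≤? toℕ w
  ...       | yes u≤w = ⊥-elim (¬tw (λ _ → wu , u≤w))
  ...       | no u≰w = w , uw , rank-index uw (≰⇒> u≰w)

  _⊏_ : Fin n → Fin n → Set
  w ⊏ u = rank w < rank u

  ⊏-wellFounded : WellFounded _⊏_
  ⊏-wellFounded = On.wellFounded rank <-wellFounded

  reachesTerminal : ∀ u → ∃ λ t → Terminal t × u ⇝ t
  reachesTerminal u = go u (⊏-wellFounded u)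
    where
    go : ∀ u → Acc _⊏_ u → ∃ λ t → Terminal t × u ⇝ t
    go u (acc below) with terminal? u
    ... | yes tu = u , tu , ⇝-refl
    ... | no ¬tu with descend ¬tu
    ...   | w , uw , w⊏u with go w (below w⊏u)
    ...     | t , tt , wt = t , tt , ⇝-trans uw wt

  terminal-independent : ∀ {s t} → Terminal s → Terminal t → s ⇝ t → s ≡ t
  terminal-independent {s} {t} ts tt st with ts t st
  ... | t⇝s , s≤t = toℕ-injective (≤-antisym s≤t (proj₂ (tt s t⇝s)))

module Walks {n m : ℕ} (D : ColoredDigraph n m) where
  open ColoredDigraph D

  len : ∀ {u v} → Walk D u v → ℕ
  len stop = 0
  len (step _ p) = suc (len p)

  _++ʷ_ : ∀ {u v w} → Walk D u v → Walk D v w → Walk D u w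
  stop ++ʷ q = q
  step a p ++ʷ q = step a (p ++ʷ q)

  -- A record, so that the walk can be inferred from a proof of minimality.
  record Shortest {u v} (p : Walk D u v) : Set where
    constructor shortest
    field minimal : (q : Walk D u v) → len p ≤ len q
  open Shortest

  shortcut : ∀ {u v} {p : Walk D u v} → Shortest p → (q : Walk D u v) → len q < len p → ⊥
  shortcut sp q q<p = <⇒≱ q<p (minimal sp q)

  shortest-tail : ∀ {u w v} {a : arc u w ≡ true} {q : Walk D w v} → Shortest (step a q) → Shortest q
  shortest-tail {a = a} sp = shortest λ q′ → ≤-pred (minimal sp (step a q′))

  start∈vertices : ∀ {u v} (q : Walk D u v) → u ∈ˡ vertices D q
  start∈vertices stop = here refl
  start∈vertices (step _ _) = here refl

  suffix : ∀ {x u v} (q : Walk D u v) → x ∈ˡ vertices D q → Σ (Walk D x v) λ q′ → len q′ ≤ len q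
  suffix stop (here refl) = stop , ≤-refl
  suffix stop (there ())
  suffix (step a q) (here refl) = step a q , ≤-refl
  suffix (step _ q) (there x∈q) with suffix q x∈q
  ... | q′ , q′≤q = q′ , ≤-trans q′≤q (n≤1+n _)

  -- A shortest walk repeats no vertex: a repetition would give a shortcut.
  shortest⇒path : ∀ {u v} (p : Walk D u v) → Shortest p → Unique (vertices D p)
  shortest⇒path stop _ = [] ∷ []
  shortest⇒path (step a q) sp =
    ¬Any⇒All¬ (vertices D q) (λ u∈q → let (q′ , q′≤q) = suffix q u∈q in shortcut sp q′ (s≤s q′≤q))
    ∷ shortest⇒path q (shortest-tail sp)

  length-vertices : ∀ {u v} (q : Walk D u v) → length (vertices D q) ≡ suc (len q)
  length-vertices stop = refl
  length-vertices (step a q) = cong suc (length-vertices q)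

  -- Being a path, a shortest walk has fewer than n arcs.
  shortest-length< : ∀ {u v} (p : Walk D u v) → Shortest p → len p < n
  shortest-length< p sp = ≤-trans (≤-reflexive (sym (length-vertices p))) (unique⇒length≤ (shortest⇒path p sp))

  Within : ℕ → Fin n → Fin n → Set
  Within k u v = Σ (Walk D u v) λ q → len q ≤ k

  within? : ∀ k u v → Dec (Within k u v)
  within? k u v with u ≟ v
  ... | yes refl = yes (stop , z≤n)
  within? zero u v | no u≢v = no λ { (stop , _) → u≢v refl ; (step _ _ , ()) }
  within? (suc k) u v | no u≢v with any? (λ w → (arc u w ≟ᵇ true) ×-dec within? k w v)
  ... | yes (w , a , q , q≤k) = yes (step a q , s≤s q≤k)
  ... | no ¬next = no λ { (stop , _) → u≢v refl ; (step {v = w} a q , s≤s q≤k) → ¬next (w , a , q , q≤k) }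

  -- Every walk can be replaced by a shortest one (search downwards in length).
  shortestWithin : ∀ {u v} k (p : Walk D u v) → len p ≤ k → Σ (Walk D u v) Shortest
  shortestWithin zero p p≤0 = p , shortest λ q → ≤-trans p≤0 z≤n
  shortestWithin {u} {v} (suc k) p p≤k+1 with within? k u v
  ... | yes (q , q≤k) = shortestWithin k q q≤k
  ... | no ¬shorter = p , shortest λ q → ≮⇒≥ (λ q<p → ¬shorter (q , ≤-pred (≤-trans q<p p≤k+1)))

  shortestWalk : ∀ {u v} → Walk D u v → Σ (Walk D u v) Shortest
  shortestWalk p = shortestWithin (len p) p ≤-refl

  -- Reachability is decidable: it suffices to look at walks of length < n.
  walk? : ∀ u v → Dec (Walk D u v)
  walk? u v with within? n u v
  ... | yes (q , _) = yes q
  ... | no ¬short = no λ p → let (q , sq) = shortestWalk p in ¬short (q , <⇒≤ (shortest-length< q sq))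

module ShortestWalkColours {n m r : ℕ} (D : ColoredDigraph n m) (part : Fin n → Fin r)
  (noArc : (u v : Fin n) → part u ≡ part v → ColoredDigraph.arc D u v ≡ false)
  (semi : (u v : Fin n) → part u ≢ part v →
          (ColoredDigraph.arc D u v ≡ true) ⊎ (ColoredDigraph.arc D v u ≡ true))
  (c3 : C3Monochromatic D) (c4 : C4Monochromatic D) where
  open ColoredDigraph D
  open Walks D

  arc⇒differentParts : ∀ {u v} → arc u v ≡ true → part u ≢ part v
  arc⇒differentParts {u} {v} a same with trans (sym a) (noArc u v same)
  ... | ()

  -- On a path x0→x1→x2→x3 without the forward chords x0→x2 and x0→x3, the
  -- first two arcs have the same colour: the missing chord is present
  -- backwards and closes a directed 3-cycle (if x0, x2 lie in different
  -- parts) or a directed 4-cycle (otherwise, since then x0, x3 do not).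
  chordless-colour : ∀ {x0 x1 x2 x3} →
    x0 ≢ x1 → x0 ≢ x2 → x0 ≢ x3 → x1 ≢ x2 → x1 ≢ x3 → x2 ≢ x3 →
    arc x0 x1 ≡ true → arc x1 x2 ≡ true → arc x2 x3 ≡ true →
    arc x0 x2 ≢ true → arc x0 x3 ≢ true → col x0 x1 ≡ col x1 x2
  chordless-colour {x0} {x1} {x2} {x3} d01 d02 d03 d12 d13 d23 a01 a12 a23 ¬a02 ¬a03
    with part x0 ≟ part x2
  ... | no p02 with semi x0 x2 p02
  ...   | inj₁ a02 = contradiction a02 ¬a02
  ...   | inj₂ a20 = proj₁ (c3 x0 x1 x2 d01 d12 d02 a01 a12 a20)
  chordless-colour {x0} {x1} {x2} {x3} d01 d02 d03 d12 d13 d23 a01 a12 a23 ¬a02 ¬a03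
      | yes p02 with semi x0 x3 (λ p03 → arc⇒differentParts a23 (trans (sym p02) p03))
  ...   | inj₁ a03 = contradiction a03 ¬a03
  ...   | inj₂ a30 = proj₁ (c4 x0 x1 x2 x3 d01 d02 d03 d12 d13 d23 a01 a12 a23 a30)

  -- In a shortest walk, any arc followed by two more arcs has the colour of
  -- its successor: the walk is a path, and a forward chord would shorten it.
  shortest-colour : ∀ {x0 x1 x2 x3 v} (a : arc x0 x1 ≡ true) (b : arc x1 x2 ≡ true)
    (c : arc x2 x3 ≡ true) (q : Walk D x3 v) →
    Shortest (step a (step b (step c q))) → col x0 x1 ≡ col x1 x2
  shortest-colour {x0} {x1} {x2} {x3} a b c q sp = fromPath (shortest⇒path _ sp)
    where
    ¬a02 : arc x0 x2 ≢ true
    ¬a02 a02 = shortcut sp (step a02 (step c q)) ≤-refl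
    ¬a03 : arc x0 x3 ≢ true
    ¬a03 a03 = shortcut sp (step a03 q) (s≤s (s≤s (n≤1+n _)))
    atStart : ∀ {P : Fin n → Set} → All P (vertices D q) → P x3
    atStart ps = All.lookup ps (start∈vertices q)
    fromPath : Unique (vertices D (step a (step b (step c q)))) → col x0 x1 ≡ col x1 x2
    fromPath ((d01 ∷ d02 ∷ d0q) ∷ (d12 ∷ d1q) ∷ d2q ∷ _) =
      chordless-colour d01 d02 (atStart d0q) d12 (atStart d1q) (atStart d2q) a b c ¬a02 ¬a03

  firstColour : ∀ {u v} → Fin m → Walk D u v → Fin m
  firstColour d stop = d
  firstColour _ (step {u = u} {v = w} _ _) = col u w

  lastColour : ∀ {u v} → Fin m → Walk D u v → Fin m
  lastColour d stop = d
  lastColour _ (step {u = u} {v = w} _ p) = lastColour (col u w) p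

  shortest-twoColours : ∀ {u v} (d : Fin m) (p : Walk D u v) → Shortest p →
    All (λ c → c ≡ firstColour d p ⊎ c ≡ lastColour d p) (colors D p)
  shortest-twoColours d stop _ = []
  shortest-twoColours d (step a stop) _ = inj₁ refl ∷ []
  shortest-twoColours d (step a (step b stop)) _ = inj₁ refl ∷ inj₂ refl ∷ []
  shortest-twoColours d (step a (step b (step c q))) sp =
    inj₁ refl ∷ All.map [ (λ same → inj₁ (trans same (sym (shortest-colour a b c q sp)))) , inj₂ ]
                        (shortest-twoColours d (step b (step c q)) (shortest-tail sp))

  walk⇒2colouredPath : ∀ {u v} → Fin m → Walk D u v → _⇝₂_ D u v
  walk⇒2colouredPath d p =
    let (q , sq) = shortestWalk p
    in q , shortest⇒path q sq , firstColour d q , lastColour d q , shortest-twoColours d q sq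

-- The hypotheses r ≥ 3 and m ≥ 1 are used only to have a vertex (D is
-- nonempty) and a colour (to name the colours of the empty walk).
mainTheorem3 : (r m n : ℕ) → r ≥ 3 → m ≥ 1 → (D : ColoredDigraph n m) →
    IsSemicompletePartite D r → C3Monochromatic D → C4Monochromatic D →
    Has2ColoredKernel D
mainTheorem3 r (suc _) n (s≤s _) _ D (part , surjective , noArc , semi) c3 c4 =
  K , nonempty , absorbing , independent
  where
  open Walks D
  open ShortestWalkColours D part noArc semi c3 c4
  open TerminalElements (Walk D) stop _++ʷ_ walk?
  K : Fin n → Bool
  K u = does (terminal? u)
  inK : ∀ {t} → Terminal t → K t ≡ true
  inK {t} = dec-true (terminal? t)
  nonempty : ∃ λ v → K v ≡ true
  nonempty = let (t , tt , _) = reachesTerminal (proj₁ (surjective Fin.zero)) in t , inK tt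
  absorbing : (u : Fin n) → K u ≡ false → ∃ λ v → (K v ≡ true) × _⇝₂_ D u v
  absorbing u _ = let (t , tt , ut) = reachesTerminal u in t , inK tt , walk⇒2colouredPath Fin.zero ut
  independent : (u v : Fin n) → K u ≡ true → K v ≡ true → u ≢ v → ¬ _⇝₂_ D u v
  independent u v Ku Kv u≢v (p , _) =
    u≢v (terminal-independent (true⇒witness (terminal? u) Ku) (true⇒witness (terminal? v) Kv) p)
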